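{- Let $D$ be a super-orientation of a chordal graph $G$. Then \[\vec{\chi}(D) \leq \left\lceil \frac{\omega(G) + \Delta(B(D))}{2} \right\rceil .\]
   Context: A graph is chordal if it has no induced cycle of length at least 4. For a digraph $D$ (no loops, no parallel arcs in the same direction), the underlying graph $\mathrm{UG}(D)$ has vertex set $V(D)$ and $uv$ is an edge iff $uv$ or $vu$ is an arc of $D$; $D$ is a super-orientation of $G$ if $G=\mathrm{UG}(D)$. A digon is a pair of arcs $uv, vu$. $B(D)$ is the undirected graph on $V(D)$ in which $uv$ is an edge iff both $uv$ and $vu$ are arcs of $D$. $\Delta$ denotes maximum degree and $\omega$ the clique number. A $k$-dicolouring of $D$ is a map $V(D)\to[k]$ such that each colour class induces an acyclic subdigraph; the dichromatic number $\vec{\chi}(D)$ is the least such $k$. -}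

module Defs where

open import Data.Nat using (ℕ; zero; suc; _+_; _≤_; _⊔_; _%_; _/_)
open import Data.Fin using (Fin; toℕ)
open import Data.Bool using (Bool; true; false; _∧_; if_then_else_)
open import Data.List using (List; map; foldr; allFin)
open import Data.Nat.ListAction using (sum)
open import Data.Product using (Σ; _×_; ∃-syntax)
open import Data.Sum using (_⊎_)
open import Relation.Binary.PropositionalEquality using (_≡_; _≢_)
open import Relation.Nullary using (¬_)
open import Function using (_⇔_)
open import Function.Definitions using (Injective)

-- A finite digraph on vertex set Fin n: arc u v ≡ true iff uv is an arc.
-- No loops; at most one arc in each direction (automatic for a Bool relation).
record Digraph (n : ℕ) : Set where
  field
    arc    : Fin n → Fin n → Bool
    noLoop : ∀ v → arc v v ≡ false
open Digraph public

UGAdj : ∀ {n} → Digraph n → Fin n → Fin n → Set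
UGAdj D u v = (arc D u v ≡ true) ⊎ (arc D v u ≡ true)

BAdj : ∀ {n} → Digraph n → Fin n → Fin n → Bool
BAdj D u v = arc D u v ∧ arc D v u

degB : ∀ {n} → Digraph n → Fin n → ℕ
degB {n} D v = sum (map (λ u → if BAdj D v u then 1 else 0) (allFin n))

-- Δ(B(D)) : maximum degree of B(D) (0 on the empty graph)
ΔB : ∀ {n} → Digraph n → ℕ
ΔB {n} D = foldr (λ v m → degB D v ⊔ m) 0 (allFin n)

CycAdj : ∀ {k} → Fin (suc k) → Fin (suc k) → Set
CycAdj {k} i j = (suc (toℕ i) % suc k ≡ toℕ j) ⊎ (suc (toℕ j) % suc k ≡ toℕ i)

InducedCycle : ∀ {n} → Digraph n → ℕ → Set
InducedCycle {n} D m =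
  Σ (Fin (4 + m) → Fin n) λ f →
    Injective _≡_ _≡_ f × (∀ i j → UGAdj D (f i) (f j) ⇔ CycAdj i j)

Chordal : ∀ {n} → Digraph n → Set
Chordal D = ∀ m → ¬ InducedCycle D m

IsClique : ∀ {n} → Digraph n → (s : ℕ) → (Fin s → Fin n) → Set
IsClique D s f = Injective _≡_ _≡_ f × (∀ i j → i ≢ j → UGAdj D (f i) (f j))

IsCliqueNumber : ∀ {n} → Digraph n → ℕ → Set
IsCliqueNumber D ω =
  (∃[ f ] IsClique D ω f) × (∀ s (f : Fin s → Fin _) → IsClique D s f → s ≤ ω)

DirCycle : ∀ {n} → Digraph n → (m : ℕ) → (Fin (2 + m) → Fin n) → Set
DirCycle {n} D m f =
  Injective _≡_ _≡_ f ×
  (∀ i j → suc (toℕ i) % (2 + m) ≡ toℕ j → arc D (f i) (f j) ≡ true)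

IsDicolouring : ∀ {n} → Digraph n → (k : ℕ) → (Fin n → Fin k) → Set
IsDicolouring {n} D k c =
  ∀ m (f : Fin (2 + m) → Fin n) → DirCycle D m f →
    ¬ (∀ i → c (f i) ≡ c (f Data.Fin.zero))

⌈_/2⌉ : ℕ → ℕ
⌈ a /2⌉ = (a + 1) / 2

-- A chordal graph always has a simplicial vertex (Dirac), so D can be coloured greedily,
-- adding back one simplicial vertex v at a time. A colour is unusable at v only if it
-- appears on both an in-neighbour and an out-neighbour of v. Weighting each neighbour of v
-- by 1, plus 1 more if it forms a digon with v, every unusable colour class has weight at
-- least 2, while the total weight is at most (ω − 1) + Δ(B(D)) because v and its neighbours
-- form a clique. So not all k = ⌈(ω + Δ(B(D)))/2⌉ colours are unusable, and a free colour
-- for v keeps every colour class acyclic: a directed cycle through v passes through an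
-- in-neighbour and an out-neighbour of v.
--
-- If a, b ∈ S are non-adjacent, let C
-- be the component of b in S ∖ N[a]. Its neighbourhood in S lies in N(a) and is a clique,
-- for otherwise a chordless path through C between two non-adjacent neighbours closes up
-- with a into an induced cycle of length at least 4. Induction on C ∪ N(C) ⊊ S then gives
-- a simplicial vertex of S inside C.

module Submission where

open import Defs
open import Data.Nat using (ℕ; _+_)
open import Data.Fin using (Fin)
open import Data.Product using (Σ)

open import Data.Bool using (true; false; if_then_else_)
import Data.Bool.Properties as Bool
open import Data.Empty using (⊥)
open import Data.Fin using (zero; suc; toℕ; fromℕ; fromℕ<; inject₁; _≟_)
import Data.Fin.Properties as Fin
open import Data.Fin.Subset using (Subset; _∈_; _∉_; _⊆_; _⊂_; ⁅_⁆; _-_; ⊤; ∣_∣)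
open import Data.Fin.Subset.Induction using (⊂-wellFounded)
open import Data.Fin.Subset.Properties
  using (_∈?_; _⊂?_; ⊆-antisym; p⊂q⇒∣p∣<∣q∣; ∣p∣≤n; x∈⁅x⁆; x∈⁅y⁆⇒x≡y; nonempty?;
         x∈p∧x≢y⇒x∈p-y; x∈p⇒p-x⊂p; ∈⊤)
open import Data.List using (map; foldr; tabulate)
open import Data.Nat using (zero; suc; _∸_; _*_; _≤_; _<_; _⊔_; _%_; _≤?_; _<?_;
                            z≤n; s≤s; s≤s⁻¹; z<s; NonZero)
open import Data.Nat.DivMod using (m≡m%n+[m/n]*n; m%n<n; n%n≡0; m<n⇒m%n≡m)
open import Data.Nat.GeneralisedArithmetic using (fold; fold-+)
open import Data.Nat.Induction using (<-wellFounded)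
import Data.Nat.ListAction as ListAction
open import Data.Nat.Properties
  using (+-comm; *-comm; +-identityʳ; +-mono-≤; +-monoʳ-≤; +-monoˡ-≤; +-monoˡ-<; +-mono-<-≤;
         ≤-refl; ≤-reflexive; ≤-trans; <-trans; ≤-<-trans; <-≤-trans; <-irrefl; <-cmp; <⇒≤; <⇒≱;
         ≤∧≮⇒≡; m≤n⇒m<n∨m≡n; m<n⇒m<1+n; n<1+n; m≤m+n; m≤n+m; m≤m⊔n; m≤n⊔m; suc-injective;
         m+[n∸m]≡n; m∸n+n≡m; m∸n≤m; m<n⇒0<n∸m; ∸-monoʳ-<; anyUpTo?; +-0-commutativeMonoid;
         module ≤-Reasoning)
open import Algebra.Properties.CommutativeMonoid.Sum +-0-commutativeMonoid
  using (sum; sum-syntax; sum-cong-≗; sum-replicate-zero; ∑-comm; ∑-distrib-+)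
open import Data.Product using (∃; ∃₂; _×_; _,_; proj₁; proj₂)
open import Data.Sum using (_⊎_; inj₁; inj₂; [_,_]; [_,_]′; swap)
import Data.Sum as Sum
open import Data.Sum.Function.Propositional using (_⊎-⇔_)
open import Data.Vec using () renaming (tabulate to tabulateᵛ)
open import Data.Vec.Properties using (lookup∘tabulate; lookup⇒[]=; []=⇒lookup)
open import Function using (_∘_; id; _⇔_; mk⇔)
open import Function.Definitions using (Injective)
import Function.Properties.Equivalence as ⇔
open import Induction.WellFounded using (Acc; acc)
open import Level using (0ℓ)
open import Relation.Binary.Definitions using (tri<; tri≈; tri>)
open import Relation.Binary.PropositionalEquality
  using (_≡_; _≢_; refl; sym; trans; cong; cong₂; subst; subst₂; module ≡-Reasoning)
open import Relation.Nullary using (Dec; yes; no; does; ¬_; contradiction)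
open import Relation.Nullary.Decidable using (_×-dec_; _⊎-dec_; ¬?; map′; dec-true; decidable-stable)
open import Relation.Unary using (Pred; Decidable)

∑-mono-≤ : ∀ {k} {f g : Fin k → ℕ} → (∀ i → f i ≤ g i) → sum f ≤ sum g
∑-mono-≤ {zero}  f≤g = z≤n
∑-mono-≤ {suc k} f≤g = +-mono-≤ (f≤g zero) (∑-mono-≤ (f≤g ∘ suc))

∑-≥-term : ∀ {k} (f : Fin k → ℕ) i → f i ≤ sum f
∑-≥-term f zero    = m≤m+n _ _
∑-≥-term f (suc i) = ≤-trans (∑-≥-term (f ∘ suc) i) (m≤n+m _ _)

∑-≥-two-terms : ∀ {k} (f : Fin k → ℕ) {i j} → i ≢ j → f i + f j ≤ sum f
∑-≥-two-terms f {zero}  {zero}  i≢j = contradiction refl i≢j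
∑-≥-two-terms f {zero}  {suc j} _   = +-monoʳ-≤ (f zero) (∑-≥-term (f ∘ suc) j)
∑-≥-two-terms f {suc i} {zero}  _   =
  ≤-trans (≤-reflexive (+-comm (f (suc i)) (f zero))) (+-monoʳ-≤ (f zero) (∑-≥-term (f ∘ suc) i))
∑-≥-two-terms f {suc i} {suc j} i≢j =
  ≤-trans (∑-≥-two-terms (f ∘ suc) (i≢j ∘ cong suc)) (m≤n+m _ _)

∑-const : ∀ k c → ∑[ i < k ] c ≡ k * c
∑-const zero    c = refl
∑-const (suc k) c = cong (c +_) (∑-const k c)

∑-delta : ∀ {k} (y : Fin k) w → ∑[ c < k ] (if does (y ≟ c) then w else 0) ≡ w
∑-delta {suc k} zero    w = trans (cong (w +_) (sum-replicate-zero k)) (+-identityʳ w)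
∑-delta {suc k} (suc y) w = ∑-delta y w

∑-by-class : ∀ {k n} (c : Fin n → Fin k) (wt : Fin n → ℕ) →
             ∑[ col < k ] ∑[ x < n ] (if does (c x ≟ col) then wt x else 0) ≡ sum wt
∑-by-class c wt = trans (∑-comm (λ col x → if does (c x ≟ col) then wt x else 0))
                        (sum-cong-≗ λ x → ∑-delta (c x) (wt x))

sum-map-tabulate : ∀ {n k} (h : Fin k → Fin n) (f : Fin n → ℕ) →
                   ListAction.sum (map f (tabulate h)) ≡ sum (f ∘ h)
sum-map-tabulate {k = zero}  h f = refl
sum-map-tabulate {k = suc k} h f = cong (f (h zero) +_) (sum-map-tabulate (h ∘ suc) f)

foldr-⊔-≥ : ∀ {n k} (g : Fin n → ℕ) (h : Fin k → Fin n) j →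
            g (h j) ≤ foldr (λ v m → g v ⊔ m) 0 (tabulate h)
foldr-⊔-≥ g h zero    = m≤m⊔n _ _
foldr-⊔-≥ g h (suc j) = ≤-trans (foldr-⊔-≥ g (h ∘ suc) j) (m≤n⊔m _ _)

n≤⌈n/2⌉+⌈n/2⌉ : ∀ n → n ≤ ⌈ n /2⌉ + ⌈ n /2⌉
n≤⌈n/2⌉+⌈n/2⌉ n = s≤s⁻¹ (begin
  suc n                          ≡⟨ +-comm 1 n ⟩
  n + 1                          ≡⟨ m≡m%n+[m/n]*n (n + 1) 2 ⟩
  (n + 1) % 2 + ⌈ n /2⌉ * 2      ≤⟨ +-monoˡ-≤ _ (s≤s⁻¹ (m%n<n (n + 1) 2)) ⟩
  1 + ⌈ n /2⌉ * 2                ≡⟨ cong suc (*-comm ⌈ n /2⌉ 2) ⟩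
  suc (⌈ n /2⌉ + (⌈ n /2⌉ + 0))  ≡⟨ cong (λ m → suc (⌈ n /2⌉ + m)) (+-identityʳ _) ⟩
  suc (⌈ n /2⌉ + ⌈ n /2⌉)        ∎)
  where open ≤-Reasoning

indicator : ∀ {p} {P : Set p} → Dec P → ℕ
indicator d = if does d then 1 else 0

indicator-yes : ∀ {p} {P : Set p} (d : Dec P) → P → indicator d ≡ 1
indicator-yes (yes _) _  = refl
indicator-yes (no ¬p) p = contradiction p ¬p

indicator-≤ : ∀ {p} {P : Set p} (d : Dec P) {b} → (P → b ≡ true) → indicator d ≤ (if b then 1 else 0)
indicator-≤ (yes p) P⇒b rewrite P⇒b p = ≤-refl
indicator-≤ (no _)  _   = z≤n

count : ∀ {n p} {P : Pred (Fin n) p} → Decidable P → ℕ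
count {n} P? = ∑[ x < n ] indicator (P? x)

enumerate : ∀ {n p} {P : Pred (Fin n) p} (P? : Decidable P) →
            Σ (Fin (count P?) → Fin n) λ e → Injective _≡_ _≡_ e × (∀ i → P (e i))
enumerate {zero}  P? = (λ ()) , (λ {i} → contradiction i Fin.¬Fin0) , λ ()
enumerate {suc n} {P = P} P? with P? zero | enumerate (P? ∘ suc)
... | no _   | e , e-inj , e-P = suc ∘ e , e-inj ∘ Fin.suc-injective , e-P
... | yes p₀ | e , e-inj , e-P = e′ , e′-inj , e′-P
  where
  e′ : Fin (suc (count (P? ∘ suc))) → Fin (suc n)
  e′ zero    = zero
  e′ (suc i) = suc (e i)
  e′-inj : Injective _≡_ _≡_ e′
  e′-inj {zero}  {zero}  _  = refl
  e′-inj {suc i} {suc j} eq = cong suc (e-inj (Fin.suc-injective eq))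
  e′-P : ∀ i → P (e′ i)
  e′-P zero    = p₀
  e′-P (suc i) = e-P i

subset : ∀ {n p} {P : Pred (Fin n) p} → Decidable P → Subset n
subset P? = tabulateᵛ (does ∘ P?)

module _ {n p} {P : Pred (Fin n) p} (P? : Decidable P) {x : Fin n} where

  ∈-subset⁺ : P x → x ∈ subset P?
  ∈-subset⁺ px = lookup⇒[]= x _ (trans (lookup∘tabulate _ x) (dec-true (P? x) px))

  ∈-subset⁻ : x ∈ subset P? → P x
  ∈-subset⁻ x∈ with P? x | trans (sym (lookup∘tabulate (does ∘ P?) x)) ([]=⇒lookup x∈)
  ... | yes px | _ = px

fold-fixpoint : ∀ {a} {A : Set a} (f : A → A) {q} → f q ≡ q → ∀ k → fold q f k ≡ q
fold-fixpoint f fq≡q zero    = refl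
fold-fixpoint f fq≡q (suc k) = trans (cong f (fold-fixpoint f fq≡q k)) fq≡q

module _ {n} (f : Subset n → Subset n) (f-inflationary : ∀ p → p ⊆ f p) where

  -- Until a fixpoint is reached every step adds an element, and a subset of Fin n has at most n.
  private
    fixpoint-or-growth : ∀ p t → (∃ λ s → s < t × f (fold p f s) ≡ fold p f s) ⊎ t ≤ ∣ fold p f t ∣
    fixpoint-or-growth p zero = inj₂ z≤n
    fixpoint-or-growth p (suc t) with fixpoint-or-growth p t | fold p f t ⊂? f (fold p f t)
    ... | inj₁ (s , s<t , fix) | _       = inj₁ (s , m<n⇒m<1+n s<t , fix)
    ... | inj₂ t≤∣q∣           | yes q⊂fq = inj₂ (<-≤-trans (s≤s t≤∣q∣) (p⊂q⇒∣p∣<∣q∣ q⊂fq))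
    ... | inj₂ _               | no q⊄fq  = inj₁ (t , n<1+n t , ⊆-antisym fq⊆q (f-inflationary q))
      where
      q = fold p f t
      fq⊆q : f q ⊆ q
      fq⊆q {x} x∈fq = decidable-stable (x ∈? q) (λ x∉q → q⊄fq (f-inflationary q , x , x∈fq , x∉q))

  fold-stabilises : ∀ p → f (fold p f n) ≡ fold p f n
  fold-stabilises p with fixpoint-or-growth p (suc n)
  ... | inj₂ n<∣q∣ = contradiction (∣p∣≤n (fold p f (suc n))) (<⇒≱ n<∣q∣)
  ... | inj₁ (s , s<1+n , fix) = trans (cong f q≡fold-s) (trans fix (sym q≡fold-s))
    where
    q≡fold-s : fold p f n ≡ fold p f s
    q≡fold-s = trans (cong (fold p f) (sym (m∸n+n≡m (s≤s⁻¹ s<1+n))))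
                     (trans (fold-+ p f (n ∸ s)) (fold-fixpoint f fix (n ∸ s)))

CyclicSucc : ℕ → ℕ → ℕ → Set
CyclicSucc N p q = suc p ≡ q ⊎ (suc p ≡ N × q ≡ 0)

suc-%-cyclic : ∀ N .{{_ : NonZero N}} {p q} → p < N → q < N → suc p % N ≡ q ⇔ CyclicSucc N p q
suc-%-cyclic N {p} {q} p<N q<N = mk⇔ to from
  where
  to : suc p % N ≡ q → CyclicSucc N p q
  to eq with m≤n⇒m<n∨m≡n p<N
  ... | inj₁ 1+p<N = inj₁ (trans (sym (m<n⇒m%n≡m 1+p<N)) eq)
  ... | inj₂ 1+p≡N = inj₂ (1+p≡N , trans (sym eq) (trans (cong (_% N) 1+p≡N) (n%n≡0 N)))
  from : CyclicSucc N p q → suc p % N ≡ q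
  from (inj₁ 1+p≡q)        = trans (m<n⇒m%n≡m (subst (_< N) (sym 1+p≡q) q<N)) 1+p≡q
  from (inj₂ (1+p≡N , q≡0)) = trans (cong (_% N) 1+p≡N) (trans (n%n≡0 N) (sym q≡0))

cycle-predecessor : ∀ m (i : Fin (2 + m)) → Σ (Fin (2 + m)) λ j → suc (toℕ j) % (2 + m) ≡ toℕ i
cycle-predecessor m zero    =
  fromℕ (suc m) , trans (cong (λ t → suc t % (2 + m)) (Fin.toℕ-fromℕ (suc m))) (n%n≡0 (2 + m))
cycle-predecessor m (suc i) =
  inject₁ i , trans (cong (λ t → suc t % (2 + m)) (Fin.toℕ-inject₁ i)) (m<n⇒m%n≡m (Fin.toℕ<n (suc i)))

cycle-successor : ∀ m (i : Fin (2 + m)) → Σ (Fin (2 + m)) λ j → suc (toℕ i) % (2 + m) ≡ toℕ j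
cycle-successor m i = fromℕ< (m%n<n (suc (toℕ i)) (2 + m)) , sym (Fin.toℕ-fromℕ< _)

-- Walks, chords and induced cycles

arc⇒≢ : ∀ {n} (D : Digraph n) {x y} → arc D x y ≡ true → x ≢ y
arc⇒≢ D {x} xy refl with () ← trans (sym (noLoop D x)) xy

module Graph {n} (D : Digraph n) where

  infix 4 _~_ _~?_

  _~_ : Fin n → Fin n → Set
  x ~ y = UGAdj D x y

  _~?_ : ∀ x y → Dec (x ~ y)
  x ~? y with arc D x y | arc D y x
  ... | true  | _     = yes (inj₁ refl)
  ... | false | true  = yes (inj₂ refl)
  ... | false | false = no λ { (inj₁ ()) ; (inj₂ ()) }

  ~-sym : ∀ {x y} → x ~ y → y ~ x
  ~-sym = swap

  ~-irrefl : ∀ {x} → ¬ x ~ x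
  ~-irrefl x~x = arc⇒≢ D ([ id , id ]′ x~x) refl

  ~⇒≢ : ∀ {x y} → x ~ y → x ≢ y
  ~⇒≢ x~y refl = ~-irrefl x~y

  record Walk (P : Pred (Fin n) 0ℓ) (x y : Fin n) : Set where
    field
      len    : ℕ
      vertex : ℕ → Fin n
      start  : vertex 0 ≡ x
      end    : vertex len ≡ y
      step   : ∀ {i} → i < len → vertex i ~ vertex (suc i)
      inner  : ∀ {i} → 0 < i → i < len → P (vertex i)
  open Walk

  Chord : ∀ {P x y} → Walk P x y → Set
  Chord w = ∃ λ i → ∃ λ j → suc i < j × j ≤ len w × vertex w i ~ vertex w j

  Chordless : ∀ {P x y} → Walk P x y → Set
  Chordless w = ¬ Chord w

  walk-map : ∀ {P Q : Pred (Fin n) 0ℓ} {x y} → (∀ {v} → P v → Q v) → Walk P x y → Walk Q x y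
  walk-map P⇒Q w = record
    { len = len w ; vertex = vertex w ; start = start w ; end = end w
    ; step = step w ; inner = λ 0<i i<L → P⇒Q (inner w 0<i i<L) }

  module _ {P : Pred (Fin n) 0ℓ} where

    trivial : ∀ {x} → Walk P x x
    trivial {x} = record
      { len = 0 ; vertex = λ _ → x ; start = refl ; end = refl
      ; step = λ () ; inner = λ _ () }

    cons : ∀ {x y z} → x ~ y → P y → Walk P y z → Walk P x z
    cons {x} x~y py w = record
      { len = suc (len w) ; vertex = vertex′ ; start = refl ; end = end w
      ; step = step′ ; inner = inner′ }
      where
      vertex′ : ℕ → Fin n
      vertex′ zero    = x
      vertex′ (suc i) = vertex w i
      step′ : ∀ {i} → i < suc (len w) → vertex′ i ~ vertex′ (suc i)
      step′ {zero}  _         = subst (x ~_) (sym (start w)) x~y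
      step′ {suc i} (s≤s i<L) = step w i<L
      inner′ : ∀ {i} → 0 < i → i < suc (len w) → P (vertex′ i)
      inner′ {suc zero}    _ _         = subst P (sym (start w)) py
      inner′ {suc (suc i)} _ (s≤s i<L) = inner w z<s i<L

    snoc : ∀ {x y z} → Walk P x y → P y → y ~ z → Walk P x z
    snoc {z = z} w py y~z = record
      { len = suc (len w) ; vertex = vertex′ ; start = start′ ; end = end′
      ; step = step′ ; inner = inner′ }
      where
      vertex′ : ℕ → Fin n
      vertex′ i with i ≤? len w
      ... | yes _ = vertex w i
      ... | no  _ = z
      start′ : vertex′ 0 ≡ _
      start′ with 0 ≤? len w
      ... | yes _   = start w
      ... | no  0≰L = contradiction z≤n 0≰L
      end′ : vertex′ (suc (len w)) ≡ z
      end′ with suc (len w) ≤? len w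
      ... | yes L<L = contradiction L<L (<-irrefl refl)
      ... | no  _   = refl
      step′ : ∀ {i} → i < suc (len w) → vertex′ i ~ vertex′ (suc i)
      step′ {i} (s≤s i≤L) with i ≤? len w | suc i ≤? len w
      ... | yes _   | yes i<L = step w i<L
      ... | yes _   | no  i≮L =
            subst (λ k → vertex w k ~ z) (sym (≤∧≮⇒≡ i≤L i≮L)) (subst (_~ z) (sym (end w)) y~z)
      ... | no  i≰L | _       = contradiction i≤L i≰L
      inner′ : ∀ {i} → 0 < i → i < suc (len w) → P (vertex′ i)
      inner′ {i} 0<i (s≤s i≤L) with i ≤? len w | m≤n⇒m<n∨m≡n i≤L
      ... | yes _   | inj₁ i<L = inner w 0<i i<L
      ... | yes _   | inj₂ refl = subst P (sym (end w)) py
      ... | no  i≰L | _        = contradiction i≤L i≰L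

    chord? : ∀ {x y} (w : Walk P x y) → Dec (Chord w)
    chord? w = map′
      (λ (j , j<1+L , i , _ , i+1<j , vi~vj) → i , j , i+1<j , s≤s⁻¹ j<1+L , vi~vj)
      (λ (i , j , i+1<j , j≤L , vi~vj) → j , s≤s j≤L , i , <-trans (n<1+n i) i+1<j , i+1<j , vi~vj)
      (anyUpTo? (λ j → anyUpTo? (λ i → suc i <? j ×-dec vertex w i ~? vertex w j) j) (suc (len w)))

    shortcut : ∀ {x y} (w : Walk P x y) → Chord w → Σ (Walk P x y) λ w′ → len w′ < len w
    shortcut {x} {y} w (i , j , i+1<j , j≤L , vi~vj) = w′ , ∸-monoʳ-< {o = 0} 0<d d≤L
      where
      d = j ∸ suc i
      i+1+d≡j : suc i + d ≡ j
      i+1+d≡j = m+[n∸m]≡n (<⇒≤ i+1<j)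
      0<d : 0 < d
      0<d = m<n⇒0<n∸m i+1<j
      d≤L : d ≤ len w
      d≤L = ≤-trans (m∸n≤m j (suc i)) j≤L
      L∸d+d≡L : len w ∸ d + d ≡ len w
      L∸d+d≡L = m∸n+n≡m d≤L
      i<L : i < len w
      i<L = ≤-trans (<-trans (n<1+n i) i+1<j) j≤L
      skip : ∀ {l} → l < len w ∸ d → l + d < len w
      skip {l} l<L∸d = subst (l + d <_) L∸d+d≡L (+-monoˡ-< d l<L∸d)
      vertex′ : ℕ → Fin n
      vertex′ l with l ≤? i
      ... | yes _ = vertex w l
      ... | no  _ = vertex w (l + d)
      start′ : vertex′ 0 ≡ x
      start′ with 0 ≤? i
      ... | yes _   = start w
      ... | no  0≰i = contradiction z≤n 0≰i
      end′ : vertex′ (len w ∸ d) ≡ y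
      end′ with len w ∸ d ≤? i
      ... | yes L∸d≤i = contradiction (+-monoˡ-≤ d L∸d≤i) (<⇒≱ (begin-strict
            i + d   <⟨ n<1+n (i + d) ⟩
            suc i + d ≡⟨ i+1+d≡j ⟩
            j       ≤⟨ j≤L ⟩
            len w   ≡⟨ L∸d+d≡L ⟨
            len w ∸ d + d ∎))
        where open ≤-Reasoning
      ... | no  _       = trans (cong (vertex w) L∸d+d≡L) (end w)
      step′ : ∀ {l} → l < len w ∸ d → vertex′ l ~ vertex′ (suc l)
      step′ {l} l<L∸d with l ≤? i | suc l ≤? i
      ... | yes _   | yes l<i = step w (<-≤-trans l<i (<⇒≤ i<L))
      ... | yes l≤i | no  l≮i with refl ← ≤∧≮⇒≡ l≤i l≮i =
            subst (λ k → vertex w l ~ vertex w k) (sym i+1+d≡j) vi~vj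
      ... | no  l≰i | yes l<i = contradiction (<⇒≤ l<i) l≰i
      ... | no  _   | no  _   = step w (skip l<L∸d)
      inner′ : ∀ {l} → 0 < l → l < len w ∸ d → P (vertex′ l)
      inner′ {l} 0<l l<L∸d with l ≤? i
      ... | yes l≤i = inner w 0<l (≤-<-trans l≤i i<L)
      ... | no  _   = inner w (<-≤-trans 0<l (m≤m+n l d)) (skip l<L∸d)
      w′ : Walk P x y
      w′ = record
        { len = len w ∸ d ; vertex = vertex′ ; start = start′ ; end = end′
        ; step = step′ ; inner = inner′ }

    repeat⇒chord : ∀ {x y} (w : Walk P x y) → x ≢ y →
                   ∀ {i j} → i < j → j ≤ len w → vertex w i ≡ vertex w j → Chord w
    repeat⇒chord w x≢y {i} {j} i<j j≤L vi≡vj with m≤n⇒m<n∨m≡n j≤L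
    ... | inj₁ j<L = i , suc j , s≤s i<j , j<L , subst (_~ vertex w (suc j)) (sym vi≡vj) (step w j<L)
    ... | inj₂ refl with i
    ...   | zero   = contradiction (trans (sym (start w)) (trans vi≡vj (end w))) x≢y
    ...   | suc i′ = i′ , j , i<j , j≤L , subst (vertex w i′ ~_) vi≡vj (step w (<-trans (n<1+n i′) i<j))

  induced-cycle : ∀ {N m} → N ≡ 4 + m → (h : ℕ → Fin n) →
    (∀ {p q} → p < N → q < N → h p ≡ h q → p ≡ q) →
    (∀ {p q} → p < N → q < N → h p ~ h q ⇔ (CyclicSucc N p q ⊎ CyclicSucc N q p)) →
    InducedCycle D m
  induced-cycle {m = m} refl h h-inj h-adj =
    h ∘ toℕ , (λ eq → Fin.toℕ-injective (h-inj (Fin.toℕ<n _) (Fin.toℕ<n _) eq)) , λ i j →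
      ⇔.trans (h-adj (Fin.toℕ<n i) (Fin.toℕ<n j)) (⇔.sym (cyclic⇔ i j ⊎-⇔ cyclic⇔ j i))
    where
    cyclic⇔ : ∀ (i j : Fin (4 + m)) → suc (toℕ i) % (4 + m) ≡ toℕ j ⇔ CyclicSucc (4 + m) (toℕ i) (toℕ j)
    cyclic⇔ i j = suc-%-cyclic (4 + m) (Fin.toℕ<n i) (Fin.toℕ<n j)

  Far : Fin n → Pred (Fin n) 0ℓ
  Far a v = v ≢ a × ¬ a ~ v

  module _ {a x y} (w : Walk (Far a) x y) (a~x : a ~ x) (a~y : a ~ y) (x≢y : x ≢ y)
           (chordless : Chordless w) where

    private
      L = len w

      position : ∀ {l} → l ≤ L → l ≡ 0 ⊎ (0 < l × l < L) ⊎ l ≡ L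
      position {zero}  _     = inj₁ refl
      position {suc l} 1+l≤L with m≤n⇒m<n∨m≡n 1+l≤L
      ... | inj₁ 1+l<L = inj₂ (inj₁ (z<s , 1+l<L))
      ... | inj₂ 1+l≡L = inj₂ (inj₂ 1+l≡L)

      vertex≢a : ∀ {l} → l ≤ L → vertex w l ≢ a
      vertex≢a l≤L with position l≤L
      ... | inj₁ refl           = λ v≡a → ~⇒≢ a~x (sym (trans (sym (start w)) v≡a))
      ... | inj₂ (inj₁ (0<l , l<L)) = proj₁ (inner w 0<l l<L)
      ... | inj₂ (inj₂ refl)    = λ v≡a → ~⇒≢ a~y (sym (trans (sym (end w)) v≡a))

      a~vertex⇒end : ∀ {l} → l ≤ L → a ~ vertex w l → l ≡ 0 ⊎ l ≡ L
      a~vertex⇒end l≤L a~v with position l≤L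
      ... | inj₁ l≡0                = inj₁ l≡0
      ... | inj₂ (inj₁ (0<l , l<L)) = contradiction a~v (proj₂ (inner w 0<l l<L))
      ... | inj₂ (inj₂ l≡L)         = inj₂ l≡L

      vertex~vertex : ∀ {i j} → i ≤ L → j ≤ L → vertex w i ~ vertex w j → suc i ≡ j ⊎ suc j ≡ i
      vertex~vertex {i} {j} i≤L j≤L vi~vj with <-cmp i j
      ... | tri≈ _ refl _ = contradiction vi~vj ~-irrefl
      ... | tri< i<j _ _ with m≤n⇒m<n∨m≡n i<j
      ...   | inj₁ i+1<j = contradiction (i , j , i+1<j , j≤L , vi~vj) chordless
      ...   | inj₂ i+1≡j = inj₁ i+1≡j
      vertex~vertex {i} {j} i≤L j≤L vi~vj | tri> _ _ j<i with m≤n⇒m<n∨m≡n j<i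
      ...   | inj₁ j+1<i = contradiction (j , i , j+1<i , i≤L , ~-sym vi~vj) chordless
      ...   | inj₂ j+1≡i = inj₂ j+1≡i

      vertex-injective : ∀ {i j} → i ≤ L → j ≤ L → vertex w i ≡ vertex w j → i ≡ j
      vertex-injective {i} {j} i≤L j≤L vi≡vj with <-cmp i j
      ... | tri< i<j _ _ = contradiction (repeat⇒chord w x≢y i<j j≤L vi≡vj) chordless
      ... | tri≈ _ i≡j _ = i≡j
      ... | tri> _ _ j<i = contradiction (repeat⇒chord w x≢y j<i i≤L (sym vi≡vj)) chordless

      N = 2 + L

      h : ℕ → Fin n
      h zero    = a
      h (suc l) = vertex w l

      h-injective : ∀ {p q} → p < N → q < N → h p ≡ h q → p ≡ q
      h-injective {zero}  {zero}  _         _         _   = refl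
      h-injective {zero}  {suc l} _         (s≤s l<)  a≡v = contradiction (sym a≡v) (vertex≢a (s≤s⁻¹ l<))
      h-injective {suc l} {zero}  (s≤s l<)  _         v≡a = contradiction v≡a (vertex≢a (s≤s⁻¹ l<))
      h-injective {suc l} {suc k} (s≤s l<)  (s≤s k<)  eq  =
        cong suc (vertex-injective (s≤s⁻¹ l<) (s≤s⁻¹ k<) eq)

      a~h⇒cyclic : ∀ {q} → q < N → a ~ h q → CyclicSucc N 0 q ⊎ CyclicSucc N q 0
      a~h⇒cyclic {zero}  _        a~a = contradiction a~a ~-irrefl
      a~h⇒cyclic {suc l} (s≤s l<) a~v with a~vertex⇒end (s≤s⁻¹ l<) a~v
      ... | inj₁ refl = inj₁ (inj₁ refl)
      ... | inj₂ refl = inj₂ (inj₂ (refl , refl))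

      h-adj⇒cyclic : ∀ {p q} → p < N → q < N → h p ~ h q → CyclicSucc N p q ⊎ CyclicSucc N q p
      h-adj⇒cyclic {zero}          _        q<       a~h = a~h⇒cyclic q< a~h
      h-adj⇒cyclic {suc l} {zero}  p<       _        v~a = swap (a~h⇒cyclic p< (~-sym v~a))
      h-adj⇒cyclic {suc l} {suc k} (s≤s l<) (s≤s k<) v~v =
        Sum.map (inj₁ ∘ cong suc) (inj₁ ∘ cong suc) (vertex~vertex (s≤s⁻¹ l<) (s≤s⁻¹ k<) v~v)

      cyclic⇒h-adj : ∀ {p q} → q < N → CyclicSucc N p q → h p ~ h q
      cyclic⇒h-adj {zero}  _                (inj₁ refl)         = subst (a ~_) (sym (start w)) a~x
      cyclic⇒h-adj {suc l} (s≤s (s≤s l<L)) (inj₁ refl)         = step w l<L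
      cyclic⇒h-adj {suc l} _                (inj₂ (1+l≡N , refl)) =
        subst (λ k → vertex w k ~ a) (sym (suc-injective (suc-injective 1+l≡N)))
              (subst (_~ a) (sym (end w)) (~-sym a~y))

    apex-cycle : ∀ {m} → L ≡ 2 + m → InducedCycle D m
    apex-cycle L≡2+m = induced-cycle (cong (2 +_) L≡2+m) h h-injective λ p< q< → mk⇔
      (h-adj⇒cyclic p< q<)
      [ cyclic⇒h-adj q< , ~-sym ∘ cyclic⇒h-adj p< ]

  module _ (chordal : Chordal D) {a x y} (a~x : a ~ x) (a~y : a ~ y) (x≢y : x ≢ y) (x≁y : ¬ x ~ y) where

    chordless-far-walk : (w : Walk (Far a) x y) → Chordless w → ⊥
    chordless-far-walk w chordless = by-length (len w) refl
      where
      by-length : ∀ k → len w ≡ k → ⊥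
      by-length 0 L≡0 = x≢y (trans (sym (start w)) (trans (cong (vertex w) (sym L≡0)) (end w)))
      by-length 1 L≡1 = x≁y (subst₂ _~_ (start w) (trans (cong (vertex w) (sym L≡1)) (end w))
                                    (step w (subst (0 <_) (sym L≡1) z<s)))
      by-length (suc (suc m)) L≡2+m = chordal m (apex-cycle w a~x a~y x≢y chordless L≡2+m)

    no-far-walk : ¬ Walk (Far a) x y
    no-far-walk w = go w (<-wellFounded (len w))
      where
      go : (w : Walk (Far a) x y) → Acc _<_ (len w) → ⊥
      go w (acc shorter) with chord? w
      ... | yes c = let w′ , w′<w = shortcut w c in go w′ (shorter w′<w)
      ... | no chordless = chordless-far-walk w chordless

  far? : ∀ a x → Dec (Far a x)
  far? a x = ¬? (x ≟ a) ×-dec ¬? (a ~? x)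

-- Simplicial vertices of chordal graphs

module ChordalGraph {n} (D : Digraph n) (chordal : Chordal D) where

  open Graph D

  Clique : Pred (Fin n) 0ℓ → Set
  Clique P = ∀ {x y} → P x → P y → x ≢ y → x ~ y

  Simplicial : Subset n → Fin n → Set
  Simplicial S s = s ∈ S × Clique (λ x → x ∈ S × s ~ x)

  clique-or-nonedge : (S : Subset n) → Clique (_∈ S) ⊎ ∃₂ λ x y → x ∈ S × y ∈ S × x ≢ y × ¬ x ~ y
  clique-or-nonedge S
    with Fin.any? (λ x → Fin.any? (λ y → x ∈? S ×-dec y ∈? S ×-dec ¬? (x ≟ y) ×-dec ¬? (x ~? y)))
  ... | yes (x , y , nonedge) = inj₂ (x , y , nonedge)
  ... | no  ¬nonedge          = inj₁ λ {x} {y} x∈S y∈S x≢y →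
        decidable-stable (x ~? y) λ x≁y → ¬nonedge (x , y , x∈S , y∈S , x≢y , x≁y)

  module Component (U : Subset n) {b} (b∈U : b ∈ U) where

    Reached : Subset n → Pred (Fin n) 0ℓ
    Reached R y = y ∈ R ⊎ (y ∈ U × ∃ λ x → x ∈ R × x ~ y)

    reached? : ∀ R y → Dec (Reached R y)
    reached? R y = y ∈? R ⊎-dec (y ∈? U ×-dec Fin.any? (λ x → x ∈? R ×-dec x ~? y))

    grow : Subset n → Subset n
    grow R = subset (reached? R)

    grow-inflationary : ∀ R → R ⊆ grow R
    grow-inflationary R x∈R = ∈-subset⁺ (reached? R) (inj₁ x∈R)

    -- layer t holds the vertices reached from b inside U in at most t steps, so C is the component of b in U.
    layer : ℕ → Subset n
    layer = fold ⁅ b ⁆ grow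

    C : Subset n
    C = layer n

    layer-⊆ : ∀ {s t} → s ≤ t → layer s ⊆ layer t
    layer-⊆ {t = zero}  z≤n = id
    layer-⊆ {t = suc t} s≤1+t with m≤n⇒m<n∨m≡n s≤1+t
    ... | inj₁ s<1+t = grow-inflationary (layer t) ∘ layer-⊆ (s≤s⁻¹ s<1+t)
    ... | inj₂ refl  = id

    b∈C : b ∈ C
    b∈C = layer-⊆ {t = n} z≤n (x∈⁅x⁆ b)

    C-closed : ∀ {x y} → x ∈ C → y ∈ U → x ~ y → y ∈ C
    C-closed {x} {y} x∈C y∈U x~y = subst (y ∈_) (fold-stabilises grow grow-inflationary ⁅ b ⁆)
      (∈-subset⁺ (reached? C) (inj₂ (y∈U , x , x∈C , x~y)))

    layer⊆U : ∀ t → layer t ⊆ U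
    layer⊆U zero    x∈ = subst (_∈ U) (sym (x∈⁅y⁆⇒x≡y b x∈)) b∈U
    layer⊆U (suc t) x∈ with ∈-subset⁻ (reached? (layer t)) x∈
    ... | inj₁ x∈layer   = layer⊆U t x∈layer
    ... | inj₂ (x∈U , _) = x∈U

    C⊆U : C ⊆ U
    C⊆U = layer⊆U n

    private
      to-root : ∀ {t c} → t ≤ n → c ∈ layer t → Walk (_∈ C) c b
      to-root {zero} _ c∈ with refl ← x∈⁅y⁆⇒x≡y b c∈ = trivial
      to-root {suc t} 1+t≤n c∈ with ∈-subset⁻ (reached? (layer t)) c∈
      ... | inj₁ c∈layer = to-root (<⇒≤ 1+t≤n) c∈layer
      ... | inj₂ (_ , x , x∈layer , x~c) =
            cons (~-sym x~c) (layer-⊆ (<⇒≤ 1+t≤n) x∈layer) (to-root (<⇒≤ 1+t≤n) x∈layer)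

      from-to : ∀ {c t c′} → c ∈ C → t ≤ n → c′ ∈ layer t → Walk (_∈ C) c c′
      from-to {t = zero} c∈C _ c′∈ with refl ← x∈⁅y⁆⇒x≡y b c′∈ = to-root ≤-refl c∈C
      from-to {t = suc t} c∈C 1+t≤n c′∈ with ∈-subset⁻ (reached? (layer t)) c′∈
      ... | inj₁ c′∈layer = from-to c∈C (<⇒≤ 1+t≤n) c′∈layer
      ... | inj₂ (_ , x , x∈layer , x~c′) =
            snoc (from-to c∈C (<⇒≤ 1+t≤n) x∈layer) (layer-⊆ (<⇒≤ 1+t≤n) x∈layer) x~c′

    C-walk : ∀ {c c′} → c ∈ C → c′ ∈ C → Walk (_∈ C) c c′
    C-walk c∈C c′∈C = from-to c∈C ≤-refl c′∈C

  module Separation {S a b} (a∈S : a ∈ S) (b∈S : b ∈ S) (b-far : Far a b) where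

    far-in-S? : ∀ x → Dec (x ∈ S × Far a x)
    far-in-S? x = x ∈? S ×-dec far? a x

    U : Subset n
    U = subset far-in-S?

    open Component U (∈-subset⁺ far-in-S? (b∈S , b-far)) public using (C; b∈C; C-closed; C⊆U; C-walk)

    C⊆S : C ⊆ S
    C⊆S = proj₁ ∘ ∈-subset⁻ far-in-S? ∘ C⊆U

    C-far : ∀ {x} → x ∈ C → Far a x
    C-far = proj₂ ∘ ∈-subset⁻ far-in-S? ∘ C⊆U

    Boundary : Pred (Fin n) 0ℓ
    Boundary x = x ∈ S × x ∉ C × ∃ λ c → c ∈ C × c ~ x

    boundary? : ∀ x → Dec (Boundary x)
    boundary? x = x ∈? S ×-dec ¬? (x ∈? C) ×-dec Fin.any? (λ c → c ∈? C ×-dec c ~? x)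

    boundary-adj : ∀ {x} → Boundary x → a ~ x
    boundary-adj {x} (x∈S , x∉C , c , c∈C , c~x) with a ~? x | x ≟ a
    ... | yes a~x | _        = a~x
    ... | no  _   | yes refl = contradiction (~-sym c~x) (proj₂ (C-far c∈C))
    ... | no  a≁x | no  x≢a  =
          contradiction (C-closed c∈C (∈-subset⁺ far-in-S? (x∈S , x≢a , a≁x)) c~x) x∉C

    boundary-clique : Clique Boundary
    boundary-clique {x} {y} bx@(_ , _ , c , c∈C , c~x) by@(_ , _ , c′ , c′∈C , c′~y) x≢y =
      decidable-stable (x ~? y) λ x≁y → no-far-walk chordal (boundary-adj bx) (boundary-adj by) x≢y x≁y
        (walk-map C-far (cons (~-sym c~x) c∈C (snoc (C-walk c∈C c′∈C) c′∈C c′~y)))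

    in-H? : ∀ x → Dec (x ∈ C ⊎ Boundary x)
    in-H? x = x ∈? C ⊎-dec boundary? x

    H : Subset n
    H = subset in-H?

    H⊂S : H ⊂ S
    H⊂S = (λ x∈H → [ C⊆S , proj₁ ]′ (∈-subset⁻ in-H? x∈H)) , a , a∈S , a∉H
      where
      a∉H : a ∉ H
      a∉H a∈H with ∈-subset⁻ in-H? a∈H
      ... | inj₁ a∈C                  = proj₁ (C-far a∈C) refl
      ... | inj₂ (_ , _ , c , c∈C , c~a) = proj₂ (C-far c∈C) (~-sym c~a)

    simplicial-lift : ∀ {s} → s ∈ C → Simplicial H s → Simplicial S s
    simplicial-lift {s} s∈C (_ , clique) = C⊆S s∈C , λ (x∈S , s~x) (y∈S , s~y) →
      clique (nbr∈H x∈S s~x , s~x) (nbr∈H y∈S s~y , s~y)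
      where
      nbr∈H : ∀ {x} → x ∈ S → s ~ x → x ∈ H
      nbr∈H {x} x∈S s~x with x ∈? C
      ... | yes x∈C = ∈-subset⁺ in-H? (inj₁ x∈C)
      ... | no  x∉C = ∈-subset⁺ in-H? (inj₂ (x∈S , x∉C , s , s∈C , s~x))

  FarSimplicial : Subset n → Fin n → Set
  FarSimplicial S a = ∃ λ s → Simplicial S s × Far a s

  far-simplicial : ∀ {S a b} → Acc _⊂_ S → a ∈ S → b ∈ S → Far a b → FarSimplicial S a
  far-simplicial {S} {a} {b} (acc smaller) a∈S b∈S b-far = from-H (clique-or-nonedge H)
    where
    open Separation a∈S b∈S b-far

    recurse : ∀ {x y} → x ∈ H → y ∈ H → Far x y → FarSimplicial H x
    recurse = far-simplicial (smaller H⊂S)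

    from-C : ∀ {s} → s ∈ C → Simplicial H s → FarSimplicial S a
    from-C s∈C s-simp = _ , simplicial-lift s∈C s-simp , C-far s∈C

    from-pair : ∀ {s₁ s₂} → Simplicial H s₁ → Simplicial H s₂ → s₁ ≢ s₂ → ¬ s₁ ~ s₂ → FarSimplicial S a
    from-pair s₁-simp@(s₁∈H , _) s₂-simp@(s₂∈H , _) s₁≢s₂ s₁≁s₂
      with ∈-subset⁻ in-H? s₁∈H | ∈-subset⁻ in-H? s₂∈H
    ... | inj₁ s₁∈C | _         = from-C s₁∈C s₁-simp
    ... | inj₂ _    | inj₁ s₂∈C = from-C s₂∈C s₂-simp
    ... | inj₂ s₁∂  | inj₂ s₂∂  = contradiction (boundary-clique s₁∂ s₂∂ s₁≢s₂) s₁≁s₂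

    from-H : Clique (_∈ H) ⊎ ∃₂ (λ x y → x ∈ H × y ∈ H × x ≢ y × ¬ x ~ y) → FarSimplicial S a
    from-H (inj₁ H-clique) =
      from-C b∈C (∈-subset⁺ in-H? (inj₁ b∈C) , λ (x∈H , _) (y∈H , _) → H-clique x∈H y∈H)
    from-H (inj₂ (x , y , x∈H , y∈H , x≢y , x≁y)) =
      let s₁ , s₁-simp , s₁≢x , x≁s₁ = recurse x∈H y∈H (x≢y ∘ sym , x≁y)
          s₂ , s₂-simp , s₂≢s₁ , s₁≁s₂ = recurse (proj₁ s₁-simp) x∈H (s₁≢x ∘ sym , x≁s₁ ∘ ~-sym)
      in from-pair s₁-simp s₂-simp (s₂≢s₁ ∘ sym) s₁≁s₂

  simplicial-exists : ∀ {S v} → v ∈ S → ∃ (Simplicial S)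
  simplicial-exists {S} {v} v∈S with clique-or-nonedge S
  ... | inj₁ S-clique = v , v∈S , λ (x∈S , _) (y∈S , _) → S-clique x∈S y∈S
  ... | inj₂ (a , b , a∈S , b∈S , a≢b , a≁b) =
        let s , s-simp , _ = far-simplicial (⊂-wellFounded S) a∈S b∈S (a≢b ∘ sym , a≁b) in s , s-simp

-- Greedy dicolouring

degB≡∑ : ∀ {n} (D : Digraph n) v → degB D v ≡ ∑[ u < n ] (if BAdj D v u then 1 else 0)
degB≡∑ D v = sum-map-tabulate id (λ u → if BAdj D v u then 1 else 0)

degB≤ΔB : ∀ {n} (D : Digraph n) v → degB D v ≤ ΔB D
degB≤ΔB D v = foldr-⊔-≥ (degB D) id v

module Colouring {n} (D : Digraph n) (chordal : Chordal D) {ω} (ω-max : IsCliqueNumber D ω)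
                 {k} (ω+Δ≤2k : ω + ΔB D ≤ k + k) where

  open Graph D
  open ChordalGraph D chordal

  AcyclicOn : Subset n → (Fin n → Fin k) → Set
  AcyclicOn S c = ∀ m f → DirCycle D m f → (∀ i → f i ∈ S) → ¬ (∀ i → c (f i) ≡ c (f zero))

  clique-with-apex : ∀ {P : Pred (Fin n) 0ℓ} (P? : Decidable P) {v} →
                     (∀ {x} → P x → v ~ x) → Clique P → suc (count P?) ≤ ω
  clique-with-apex P? {v} v~P P-clique = proj₂ ω-max _ vertex (vertex-injective , vertex-adj)
    where
    e = proj₁ (enumerate P?)
    e-injective = proj₁ (proj₂ (enumerate P?))
    e-P = proj₂ (proj₂ (enumerate P?))
    vertex : Fin (suc (count P?)) → Fin n
    vertex zero    = v
    vertex (suc i) = e i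
    vertex-injective : Injective _≡_ _≡_ vertex
    vertex-injective {zero}  {zero}  _  = refl
    vertex-injective {zero}  {suc j} eq = contradiction eq (~⇒≢ (v~P (e-P j)))
    vertex-injective {suc i} {zero}  eq = contradiction (sym eq) (~⇒≢ (v~P (e-P i)))
    vertex-injective {suc i} {suc j} eq = cong suc (e-injective eq)
    vertex-adj : ∀ i j → i ≢ j → vertex i ~ vertex j
    vertex-adj zero    zero    i≢j = contradiction refl i≢j
    vertex-adj zero    (suc j) _   = v~P (e-P j)
    vertex-adj (suc i) zero    _   = ~-sym (v~P (e-P i))
    vertex-adj (suc i) (suc j) i≢j = P-clique (e-P i) (e-P j) (i≢j ∘ cong suc ∘ e-injective)

  -- Only used to colour the empty set; a vertex v is a clique, so 1 ≤ ω ≤ k + k.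
  some-colour : Fin n → Fin k
  some-colour v = fromℕ< (positive (≤-trans (≤-trans 1≤ω (m≤m+n ω (ΔB D))) ω+Δ≤2k))
    where
    1≤ω : 1 ≤ ω
    1≤ω = ≤-trans (s≤s z≤n) (clique-with-apex {P = λ _ → ⊥} (λ _ → no id) {v} (λ ()) (λ ()))
    positive : ∀ {k} → 1 ≤ k + k → 0 < k
    positive {suc k} _ = z<s

  module Extend {S v} (v-simplicial : Simplicial S v)
                (c′ : Fin n → Fin k) (c′-acyclic : AcyclicOn (S - v) c′) where

    Blocked : Fin k → Set
    Blocked col = ∃₂ λ u w → u ∈ S × w ∈ S × arc D u v ≡ true × arc D v w ≡ true ×
                             c′ u ≡ col × c′ w ≡ col

    blocked? : ∀ col → Dec (Blocked col)
    blocked? col = Fin.any? λ u → Fin.any? λ w → u ∈? S ×-dec w ∈? S ×-dec arc D u v Bool.≟ true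
      ×-dec arc D v w Bool.≟ true ×-dec c′ u ≟ col ×-dec c′ w ≟ col

    neighbour? : ∀ x → Dec (x ∈ S × v ~ x)
    neighbour? x = x ∈? S ×-dec v ~? x

    digon? : ∀ x → Dec (x ∈ S × BAdj D v x ≡ true)
    digon? x = x ∈? S ×-dec BAdj D v x Bool.≟ true

    weight : Fin n → ℕ
    weight x = indicator (neighbour? x) + indicator (digon? x)

    class-weight : Fin k → Fin n → ℕ
    class-weight col x = if does (c′ x ≟ col) then weight x else 0

    class-weight-≡ : ∀ {col x} → c′ x ≡ col → class-weight col x ≡ weight x
    class-weight-≡ {col} {x} c′x≡col with c′ x ≟ col
    ... | yes _       = refl
    ... | no  c′x≢col = contradiction c′x≡col c′x≢col

    neighbour-weight : ∀ {col x} → x ∈ S → v ~ x → c′ x ≡ col → 1 ≤ class-weight col x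
    neighbour-weight {col} {x} x∈S v~x c′x≡col = begin
      1                                    ≡⟨ indicator-yes (neighbour? x) (x∈S , v~x) ⟨
      indicator (neighbour? x)             ≤⟨ m≤m+n _ _ ⟩
      weight x                             ≡⟨ class-weight-≡ c′x≡col ⟨
      class-weight col x                   ∎
      where open ≤-Reasoning

    blocked-weight : ∀ {col} → Blocked col → 2 ≤ ∑[ x < n ] class-weight col x
    blocked-weight {col} (u , w , u∈S , w∈S , uv , vw , c′u , c′w) with u ≟ w
    ... | yes refl = begin
      2                              ≡⟨ cong₂ _+_ (indicator-yes (neighbour? u) (u∈S , inj₂ uv))
                                                  (indicator-yes (digon? u) (u∈S , v⇄u)) ⟨
      weight u                       ≡⟨ class-weight-≡ c′u ⟨
      class-weight col u             ≤⟨ ∑-≥-term (class-weight col) u ⟩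
      ∑[ x < n ] class-weight col x  ∎
      where
      open ≤-Reasoning
      v⇄u : BAdj D v u ≡ true
      v⇄u rewrite vw | uv = refl
    ... | no u≢w =
      ≤-trans (+-mono-≤ (neighbour-weight u∈S (inj₂ uv) c′u) (neighbour-weight w∈S (inj₁ vw) c′w))
              (∑-≥-two-terms (class-weight col) u≢w)

    neighbour-bound : count neighbour? < ω
    neighbour-bound = clique-with-apex neighbour? proj₂ (proj₂ v-simplicial)

    digon-bound : count digon? ≤ ΔB D
    digon-bound = begin
      count digon?                                  ≤⟨ ∑-mono-≤ (λ x → indicator-≤ (digon? x) proj₂) ⟩
      ∑[ u < n ] (if BAdj D v u then 1 else 0)      ≡⟨ degB≡∑ D v ⟨
      degB D v                                      ≤⟨ degB≤ΔB D v ⟩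
      ΔB D                                          ∎
      where open ≤-Reasoning

    free-colour : ∃ λ col → ¬ Blocked col
    free-colour with Fin.any? (λ col → ¬? (blocked? col))
    ... | yes free = free
    ... | no  none = contradiction ω+Δ≤2k (<⇒≱ (begin-strict
      k + k                                       ≡⟨ cong (k +_) (+-identityʳ k) ⟨
      2 * k                                       ≡⟨ *-comm 2 k ⟩
      k * 2                                       ≡⟨ ∑-const k 2 ⟨
      ∑[ col < k ] 2                              ≤⟨ ∑-mono-≤ (λ col → blocked-weight (blocked col)) ⟩
      ∑[ col < k ] ∑[ x < n ] class-weight col x  ≡⟨ ∑-by-class c′ weight ⟩
      sum weight                                  ≡⟨ ∑-distrib-+ (indicator ∘ neighbour?) _ ⟩
      count neighbour? + count digon?             <⟨ +-mono-<-≤ neighbour-bound digon-bound ⟩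
      ω + ΔB D                                    ∎))
      where
      open ≤-Reasoning
      blocked : ∀ col → Blocked col
      blocked col = decidable-stable (blocked? col) λ ¬blocked → none (col , ¬blocked)

    col : Fin k
    col = proj₁ free-colour

    c : Fin n → Fin k
    c x with x ≟ v
    ... | yes _ = col
    ... | no  _ = c′ x

    c-v : c v ≡ col
    c-v with v ≟ v
    ... | yes _   = refl
    ... | no  v≢v = contradiction refl v≢v

    c-elsewhere : ∀ {x} → x ≢ v → c x ≡ c′ x
    c-elsewhere {x} x≢v with x ≟ v
    ... | yes x≡v = contradiction x≡v x≢v
    ... | no  _   = refl

    c-acyclic : AcyclicOn S c
    c-acyclic m f f-cycle@(_ , f-arc) f∈S mono with Fin.any? (λ i → f i ≟ v)
    ... | no v∉f = c′-acyclic m f f-cycle (λ i → x∈p∧x≢y⇒x∈p-y (f∈S i) (off-v i)) λ i →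
          trans (sym (c-elsewhere (off-v i))) (trans (mono i) (c-elsewhere (off-v zero)))
      where
      off-v : ∀ i → f i ≢ v
      off-v i fi≡v = v∉f (i , fi≡v)
    ... | yes (i , fi≡v) = proj₂ free-colour (f p , f s , f∈S p , f∈S s , into-v , out-of-v ,
                              coloured (arc⇒≢ D into-v) , coloured (arc⇒≢ D out-of-v ∘ sym))
      where
      p = proj₁ (cycle-predecessor m i)
      s = proj₁ (cycle-successor m i)
      into-v : arc D (f p) v ≡ true
      into-v = subst (λ z → arc D (f p) z ≡ true) fi≡v (f-arc p i (proj₂ (cycle-predecessor m i)))
      out-of-v : arc D v (f s) ≡ true
      out-of-v = subst (λ z → arc D z (f s) ≡ true) fi≡v (f-arc i s (proj₂ (cycle-successor m i)))
      coloured : ∀ {j} → f j ≢ v → c′ (f j) ≡ col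
      coloured {j} fj≢v = begin
        c′ (f j)  ≡⟨ c-elsewhere fj≢v ⟨
        c (f j)   ≡⟨ trans (mono j) (sym (mono i)) ⟩
        c (f i)   ≡⟨ cong c fi≡v ⟩
        c v       ≡⟨ c-v ⟩
        col       ∎
        where open ≡-Reasoning

  colour : ∀ S → Acc _⊂_ S → Σ (Fin n → Fin k) (AcyclicOn S)
  colour S (acc smaller) with nonempty? S
  ... | no S-empty = some-colour , λ m f _ f∈S _ → S-empty (f zero , f∈S zero)
  ... | yes (_ , u∈S) with simplicial-exists u∈S
  ...   | v , v-simplicial@(v∈S , _) with colour (S - v) (smaller (x∈p⇒p-x⊂p v∈S))
  ...     | c′ , c′-acyclic = c , c-acyclic
    where open Extend v-simplicial c′ c′-acyclic

mainTheorem3 : ∀ {n} (D : Digraph n) (ω : ℕ) → Chordal D → IsCliqueNumber D ω →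
    Σ (Fin n → Fin ⌈ ω + ΔB D /2⌉) λ c → IsDicolouring D ⌈ ω + ΔB D /2⌉ c
mainTheorem3 D ω chordal ω-max =
  let c , c-acyclic = colour ⊤ (⊂-wellFounded ⊤)
  in c , λ m f f-cycle → c-acyclic m f f-cycle (λ _ → ∈⊤)
  where open Colouring D chordal ω-max {⌈ ω + ΔB D /2⌉} (n≤⌈n/2⌉+⌈n/2⌉ (ω + ΔB D))
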